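{- Let $s>r>1$ be integers and let $K_{r,s}$ be the complete bipartite graph with vertex bipartition $R=\{v_1,\dots,v_r\}$, $S=\{w_1,\dots,w_s\}$ and edge set $E(K_{r,s})$. For each $t\in R$ define $\alpha^t_{v}=s-(r-1)$ if $v=t$ and $\alpha^t_v=1$ for $v\in R\setminus\{t\}$. Then for every $t\in R$ the non-balanced lifted biclique inequality \[ \sum_{v\in R}\alpha^t_v x_v+\sum_{w\in S}x_w+\sum_{e\in E(K_{r,s})}y_e\le s \] defines a facet of $P_T(K_{r,s})$.
   Context: For a graph $G=(V,E)$, two elements of $V\cup E$ are adjacent if they are adjacent vertices, incident (sharing an endpoint) edges, or an edge and one of its endpoints; otherwise they are independent. A total matching is a subset $T\subseteq V\cup E$ of pairwise independent elements. The Total Matching Polytope $P_T(G)\subseteq\mathbb{R}^{|V|+|E|}$ is the convex hull of the characteristic vectors $\chi[T]=(x,y)\in\{0,1\}^{V}\times\{0,1\}^{E}$ of all total matchings $T$ ($x$ vertex coordinates, $y$ edge coordinates; a coordinate equals $1$ iff the corresponding element lies in $T$).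
   Formalization: The Total Matching Polytope $P_T(K_{r,s})$ is taken over ℚ, with rational convex combinations and affine rank over ℚ, rather than in $\mathbb{R}^{|V|+|E|}$. -}

module Defs where

open import Data.Nat as ℕ using (ℕ; zero; suc; _∸_)
open import Data.Integer using (+_)
open import Data.Rational using (ℚ; 0ℚ; 1ℚ; _+_; _*_; _≤_; _/_)
open import Data.Fin using (Fin; zero; suc; splitAt; _↑ˡ_; _↑ʳ_; remQuot; _≟_)
open import Data.Product using (Σ; ∃; _×_; _,_; proj₁; proj₂)
open import Data.Sum using (_⊎_; inj₁; inj₂)
open import Data.Bool using (Bool; true; false; if_then_else_)
open import Relation.Nullary using (¬_; yes; no)
open import Relation.Binary.PropositionalEquality using (_≡_; _≢_)

ℕ→ℚ : ℕ → ℚ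
ℕ→ℚ n = (+ n) / 1

sumℚ : ∀ {k} → (Fin k → ℚ) → ℚ
sumℚ {zero}  f = 0ℚ
sumℚ {suc k} f = f zero + sumℚ (λ i → f (suc i))

record Graph : Set where
  field
    nV   : ℕ
    nE   : ℕ
    ends : Fin nE → Fin nV × Fin nV

module _ (G : Graph) where
  open Graph G

  Elem : Set
  Elem = Fin nV ⊎ Fin nE

  Incident : Fin nV → Fin nE → Set
  Incident v e = (proj₁ (ends e) ≡ v) ⊎ (proj₂ (ends e) ≡ v)

  Adjacent : Elem → Elem → Set
  Adjacent (inj₁ u) (inj₁ v) = ∃ λ e → (ends e ≡ (u , v)) ⊎ (ends e ≡ (v , u))
  Adjacent (inj₂ e) (inj₂ f) = ∃ λ v → Incident v e × Incident v f
  Adjacent (inj₁ v) (inj₂ e) = Incident v e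
  Adjacent (inj₂ e) (inj₁ v) = Incident v e

  IsTotalMatching : (Elem → Bool) → Set
  IsTotalMatching T = ∀ a b → T a ≡ true → T b ≡ true → a ≢ b → ¬ Adjacent a b

  Point : Set
  Point = Elem → ℚ

  χ : (Elem → Bool) → Point
  χ T c = if T c then 1ℚ else 0ℚ

  dot : Point → Point → ℚ
  dot a p = sumℚ (λ v → a (inj₁ v) * p (inj₁ v)) + sumℚ (λ e → a (inj₂ e) * p (inj₂ e))

  InPT : Point → Set
  InPT p = Σ ℕ λ k → Σ (Fin k → (Elem → Bool)) λ T → Σ (Fin k → ℚ) λ λs →
             (∀ i → IsTotalMatching (T i)) ×
             (∀ i → 0ℚ ≤ λs i) ×
             (sumℚ λs ≡ 1ℚ) ×
             (∀ c → p c ≡ sumℚ (λ i → λs i * χ (T i) c))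

  AffInd : ∀ {k} → (Fin k → Point) → Set
  AffInd {k} p = (μ : Fin k → ℚ) → sumℚ μ ≡ 0ℚ →
                 (∀ c → sumℚ (λ i → μ i * p i c) ≡ 0ℚ) → ∀ i → μ i ≡ 0ℚ

  -- X has affine rank m (= dimension + 1): maximum number of affinely
  -- independent points of X is m
  HasAffRank : (Point → Set) → ℕ → Set
  HasAffRank X m =
    (Σ (Fin m → Point) λ p → (∀ i → X (p i)) × AffInd p) ×
    ((q : Fin (suc m) → Point) → (∀ i → X (q i)) → ¬ AffInd q)

  -- the inequality a·(x,y) ≤ b defines a facet of P_T(G):
  -- it is valid, and its face has dimension dim P_T(G) − 1
  DefinesFacet : Point → ℚ → Set
  DefinesFacet a b =
    (∀ p → InPT p → dot a p ≤ b) ×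
    (Σ ℕ λ m → HasAffRank InPT (suc m) ×
               HasAffRank (λ p → InPT p × (dot a p ≡ b)) m)

-- complete bipartite graph K_{r,s}: vertices v_i = i ↑ˡ s (i : Fin r),
-- w_j = r ↑ʳ j (j : Fin s); edge combine i j joins v_i and w_j
K : ℕ → ℕ → Graph
K r s = record
  { nV = r ℕ.+ s
  ; nE = r ℕ.* s
  ; ends = λ e → let ij = remQuot {r} s e in (proj₁ ij ↑ˡ s , r ↑ʳ proj₂ ij)
  }

liftedBiclique : (r s : ℕ) → Fin r → Point (K r s)
liftedBiclique r s t (inj₁ u) with splitAt r u
... | inj₁ i with i ≟ t
...   | yes _ = ℕ→ℚ (s ∸ (r ∸ 1))
...   | no _  = 1ℚ
liftedBiclique r s t (inj₁ u) | inj₂ _ = 1ℚ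
liftedBiclique r s t (inj₂ e) = 1ℚ

module Submission where

-- Validity: a total matching that meets R misses all of S, so it spends at most 1 on each vertex
-- v ∈ R together with its edges, plus the extra s − r on t, for a total of s; one that misses R
-- spends at most 1 on each vertex w ∈ S together with its edges.
-- Facet: P_T is full dimensional (∅ and the singletons), so a valid inequality with nonzero
-- right-hand side is a facet once it is tight at |V| + |E| affinely independent total matchings.
-- For K_{r,s} take R; S; R ∖ {v} plus the edge v w₀ (v ≠ t); R ∖ {v₁} plus the edge v₁ w
-- (w ≠ w₀, v₁ ≠ t fixed); and S ∖ {w} plus the edge v w for every edge.  Their independence follows
-- from affine functionals whose values on these points form a unitriangular matrix.

open import Algebra.Bundles using (Ring)
open import Data.Bool as Bool using (Bool; true; false; if_then_else_; not; _∧_)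
open import Data.Bool.Properties using (¬-not; ∧-identityʳ; ∧-zeroʳ; ∧-comm)
open import Data.Empty using (⊥; ⊥-elim)
open import Data.Fin as Fin using (Fin; zero; suc; _↑ˡ_; _↑ʳ_; splitAt; punchIn; combine; remQuot)
import Data.Fin.Properties as Fin
import Data.Integer as ℤ
import Data.Integer.Properties as ℤ
open import Data.Nat as ℕ using (ℕ; zero; suc; _∸_; _<_; z≤n; s≤s)
open import Data.Nat.Coprimality as Coprime using (1-coprimeTo)
import Data.Nat.Properties as ℕ
open import Data.Product using (∃-syntax; _×_; _,_; proj₁; proj₂; uncurry)
open import Data.Rational hiding (_<_)
open import Data.Rational.Properties
open import Data.Rational.Solver using (module +-*-Solver)
open import Data.Sum using (_⊎_; inj₁; inj₂; [_,_]′)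
open import Data.Sum.Properties using (≡-dec; inj₁-injective; inj₂-injective)
open import Data.Vec.Functional using (insertAt; _∷_)
open import Data.Vec.Functional.Properties using (insertAt-lookup; insertAt-punchIn)
open import Function using (_∘_)
open import Relation.Binary.PropositionalEquality
open import Relation.Nullary using (¬_; Dec; yes; no; does)
open import Relation.Nullary.Decidable using (decidable-stable; dec-true; dec-false)

open import Algebra.Properties.Semiring.Sum (Ring.semiring +-*-ring) as Sum using ()

open import Defs

ℕ→ℚ≡mkℚ : ∀ n → ℕ→ℚ n ≡ mkℚ (ℤ.+ n) 0 (Coprime.sym (1-coprimeTo n))
ℕ→ℚ≡mkℚ n = normalize-coprime (Coprime.sym (1-coprimeTo n))

ℕ→ℚ-suc : ∀ n → ℕ→ℚ (suc n) ≡ 1ℚ + ℕ→ℚ n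
ℕ→ℚ-suc n = sym (trans (cong (1ℚ +_) (ℕ→ℚ≡mkℚ n)) (cong (λ z → (ℤ.+ 1 ℤ.+ z) / 1) (ℤ.*-identityʳ (ℤ.+ n))))

ℕ→ℚ-+ : ∀ m n → ℕ→ℚ (m ℕ.+ n) ≡ ℕ→ℚ m + ℕ→ℚ n
ℕ→ℚ-+ zero    n = sym (+-identityˡ (ℕ→ℚ n))
ℕ→ℚ-+ (suc m) n = begin
  ℕ→ℚ (suc m ℕ.+ n)          ≡⟨ ℕ→ℚ-suc (m ℕ.+ n) ⟩
  1ℚ + ℕ→ℚ (m ℕ.+ n)         ≡⟨ cong (1ℚ +_) (ℕ→ℚ-+ m n) ⟩
  1ℚ + (ℕ→ℚ m + ℕ→ℚ n)       ≡⟨ +-assoc 1ℚ (ℕ→ℚ m) (ℕ→ℚ n) ⟨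
  (1ℚ + ℕ→ℚ m) + ℕ→ℚ n       ≡⟨ cong (_+ ℕ→ℚ n) (ℕ→ℚ-suc m) ⟨
  ℕ→ℚ (suc m) + ℕ→ℚ n        ∎
  where open ≡-Reasoning

ℕ→ℚ-nonNeg : ∀ n → 0ℚ ≤ ℕ→ℚ n
ℕ→ℚ-nonNeg n rewrite ℕ→ℚ≡mkℚ n = nonNegative⁻¹ _

ℕ→ℚ-suc≢0 : ∀ n → ℕ→ℚ (suc n) ≢ 0ℚ
ℕ→ℚ-suc≢0 n rewrite ℕ→ℚ≡mkℚ (suc n) = λ ()

*-cancelˡ-≡0 : ∀ {x y} → x ≢ 0ℚ → x * y ≡ 0ℚ → y ≡ 0ℚ
*-cancelˡ-≡0 {x} {y} x≢0 xy≡0 = begin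
  y                ≡⟨ *-identityˡ y ⟨
  1ℚ * y           ≡⟨ cong (_* y) (*-inverseˡ x) ⟨
  (1/ x) * x * y   ≡⟨ *-assoc (1/ x) x y ⟩
  (1/ x) * (x * y) ≡⟨ cong ((1/ x) *_) xy≡0 ⟩
  (1/ x) * 0ℚ      ≡⟨ *-zeroʳ (1/ x) ⟩
  0ℚ               ∎
  where
  open ≡-Reasoning
  instance _ = ≢-nonZero x≢0

*-≢0 : ∀ {x y} → x ≢ 0ℚ → y ≢ 0ℚ → x * y ≢ 0ℚ
*-≢0 x≢0 y≢0 = y≢0 ∘ *-cancelˡ-≡0 x≢0

-- Finite sums

sumℚ≡sum : ∀ {k} (f : Fin k → ℚ) → sumℚ f ≡ Sum.sum f
sumℚ≡sum {zero}  f = refl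
sumℚ≡sum {suc k} f = cong (f zero +_) (sumℚ≡sum (f ∘ suc))

sumℚ-cong : ∀ {k} {f g : Fin k → ℚ} → (∀ i → f i ≡ g i) → sumℚ f ≡ sumℚ g
sumℚ-cong {zero}  f≗g = refl
sumℚ-cong {suc k} f≗g = cong₂ _+_ (f≗g zero) (sumℚ-cong (f≗g ∘ suc))

sumℚ-distrib-+ : ∀ {k} (f g : Fin k → ℚ) → sumℚ (λ i → f i + g i) ≡ sumℚ f + sumℚ g
sumℚ-distrib-+ f g = begin
  sumℚ (λ i → f i + g i)    ≡⟨ sumℚ≡sum (λ i → f i + g i) ⟩
  Sum.sum (λ i → f i + g i) ≡⟨ Sum.∑-distrib-+ f g ⟩
  Sum.sum f + Sum.sum g     ≡⟨ cong₂ _+_ (sumℚ≡sum f) (sumℚ≡sum g) ⟨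
  sumℚ f + sumℚ g           ∎
  where open ≡-Reasoning

*-distribˡ-sumℚ : ∀ {k} x (f : Fin k → ℚ) → x * sumℚ f ≡ sumℚ (λ i → x * f i)
*-distribˡ-sumℚ x f = begin
  x * sumℚ f                ≡⟨ cong (x *_) (sumℚ≡sum f) ⟩
  x * Sum.sum f             ≡⟨ Sum.*-distribˡ-sum x f ⟩
  Sum.sum (λ i → x * f i)   ≡⟨ sumℚ≡sum (λ i → x * f i) ⟨
  sumℚ (λ i → x * f i)      ∎
  where open ≡-Reasoning

sumℚ-comm : ∀ {m n} (f : Fin m → Fin n → ℚ) →
            sumℚ (λ i → sumℚ (f i)) ≡ sumℚ (λ j → sumℚ (λ i → f i j))
sumℚ-comm f = begin
  sumℚ (λ i → sumℚ (f i))                 ≡⟨ trans (sumℚ-cong (λ i → sumℚ≡sum (f i))) (sumℚ≡sum (λ i → Sum.sum (f i))) ⟩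
  Sum.sum (λ i → Sum.sum (f i))           ≡⟨ Sum.∑-comm f ⟩
  Sum.sum (λ j → Sum.sum (λ i → f i j))   ≡⟨ trans (sumℚ-cong (λ j → sumℚ≡sum (λ i → f i j))) (sumℚ≡sum (λ j → Sum.sum (λ i → f i j))) ⟨
  sumℚ (λ j → sumℚ (λ i → f i j))         ∎
  where open ≡-Reasoning

sumℚ-remove : ∀ {k} (i : Fin (suc k)) (f : Fin (suc k) → ℚ) → sumℚ f ≡ f i + sumℚ (f ∘ punchIn i)
sumℚ-remove i f = begin
  sumℚ f                      ≡⟨ sumℚ≡sum f ⟩
  Sum.sum f                   ≡⟨ Sum.sum-remove f ⟩
  f i + Sum.sum (f ∘ punchIn i) ≡⟨ cong (f i +_) (sumℚ≡sum (f ∘ punchIn i)) ⟨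
  f i + sumℚ (f ∘ punchIn i)  ∎
  where open ≡-Reasoning

sumℚ-neg : ∀ {k} (f : Fin k → ℚ) → sumℚ (λ i → - f i) ≡ - sumℚ f
sumℚ-neg {zero}  f = refl
sumℚ-neg {suc k} f = trans (cong (- f zero +_) (sumℚ-neg (f ∘ suc))) (sym (neg-distrib-+ (f zero) _))

sumℚ-zero : ∀ {k} {f : Fin k → ℚ} → (∀ i → f i ≡ 0ℚ) → sumℚ f ≡ 0ℚ
sumℚ-zero {zero}  f≗0 = refl
sumℚ-zero {suc k} f≗0 = trans (cong₂ _+_ (f≗0 zero) (sumℚ-zero (f≗0 ∘ suc))) (+-identityˡ 0ℚ)

sumℚ-lookup : ∀ {k} (f : Fin k → ℚ) (j : Fin k) → (∀ i → i ≢ j → f i ≡ 0ℚ) → sumℚ f ≡ f j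
sumℚ-lookup {suc k} f j f≗0 = begin
  sumℚ f                    ≡⟨ sumℚ-remove j f ⟩
  f j + sumℚ (f ∘ punchIn j) ≡⟨ cong (f j +_) (sumℚ-zero (λ i → f≗0 _ (Fin.punchInᵢ≢i j i))) ⟩
  f j + 0ℚ                  ≡⟨ +-identityʳ (f j) ⟩
  f j                       ∎
  where open ≡-Reasoning

sumℚ-mono-≤ : ∀ {k} {f g : Fin k → ℚ} → (∀ i → f i ≤ g i) → sumℚ f ≤ sumℚ g
sumℚ-mono-≤ {zero}  f≤g = ≤-refl
sumℚ-mono-≤ {suc k} f≤g = +-mono-≤ (f≤g zero) (sumℚ-mono-≤ (f≤g ∘ suc))

sumℚ-0 : ∀ k → sumℚ {k} (λ _ → 0ℚ) ≡ 0ℚ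
sumℚ-0 k = sumℚ-zero {k} (λ _ → refl)

sumℚ-const-1 : ∀ k → sumℚ {k} (λ _ → 1ℚ) ≡ ℕ→ℚ k
sumℚ-const-1 zero    = refl
sumℚ-const-1 (suc k) = trans (cong (1ℚ +_) (sumℚ-const-1 k)) (sym (ℕ→ℚ-suc k))

sumℚ-splitAt : ∀ m {n} (f : Fin (m ℕ.+ n) → ℚ) →
               sumℚ f ≡ sumℚ (λ i → f (i ↑ˡ n)) + sumℚ (λ j → f (m ↑ʳ j))
sumℚ-splitAt zero    f = sym (+-identityˡ _)
sumℚ-splitAt (suc m) f = trans (cong (f zero +_) (sumℚ-splitAt m (f ∘ suc))) (sym (+-assoc (f zero) _ _))

sumℚ-combine : ∀ m {n} (f : Fin (m ℕ.* n) → ℚ) →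
               sumℚ f ≡ sumℚ (λ i → sumℚ (λ j → f (combine {m} {n} i j)))
sumℚ-combine zero        f = refl
sumℚ-combine (suc m) {n} f =
  trans (sumℚ-splitAt n f) (cong (sumℚ (λ j → f (j ↑ˡ (m ℕ.* n))) +_) (sumℚ-combine m (λ k → f (n ↑ʳ k))))

𝟙 : Bool → ℚ
𝟙 b = if b then 1ℚ else 0ℚ

𝟙≤1 : ∀ b → 𝟙 b ≤ 1ℚ
𝟙≤1 true  = ≤-refl
𝟙≤1 false = ℕ→ℚ-nonNeg 1

𝟙-not+𝟙 : ∀ b → 𝟙 (not b) + 𝟙 b ≡ 1ℚ
𝟙-not+𝟙 true  = +-identityˡ 1ℚ
𝟙-not+𝟙 false = +-identityʳ 1ℚ

sumℚ-𝟙-atMostOne : ∀ {k} (g : Fin k → Bool) → (∀ i j → g i ≡ true → g j ≡ true → i ≡ j) → sumℚ (𝟙 ∘ g) ≤ 1ℚ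
sumℚ-𝟙-atMostOne {zero}  g _      = ℕ→ℚ-nonNeg 1
sumℚ-𝟙-atMostOne {suc k} g unique with g zero in g₀
... | true  = ≤-reflexive (trans (cong (1ℚ +_) (sumℚ-zero (λ i → cong 𝟙 (¬-not (Fin.0≢1+n ∘ unique zero (suc i) g₀)))))
                                 (+-identityʳ 1ℚ))
... | false = ≤-trans (≤-reflexive (+-identityˡ _))
                      (sumℚ-𝟙-atMostOne (g ∘ suc) (λ i j gi gj → Fin.suc-injective (unique (suc i) (suc j) gi gj)))

𝟙+sumℚ-𝟙-≤1 : ∀ {k} b (g : Fin k → Bool) → (∀ i → b ≡ true → g i ≡ true → ⊥) →
               (∀ i j → g i ≡ true → g j ≡ true → i ≡ j) → 𝟙 b + sumℚ (𝟙 ∘ g) ≤ 1ℚ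
𝟙+sumℚ-𝟙-≤1 b g exclusive unique = sumℚ-𝟙-atMostOne (b ∷ g) unique′
  where
  unique′ : ∀ i j → (b ∷ g) i ≡ true → (b ∷ g) j ≡ true → i ≡ j
  unique′ zero    zero    _  _  = refl
  unique′ zero    (suc j) b∈ gj = ⊥-elim (exclusive j b∈ gj)
  unique′ (suc i) zero    gi b∈ = ⊥-elim (exclusive i b∈ gi)
  unique′ (suc i) (suc j) gi gj = cong suc (unique i j gi gj)

_==_ : ∀ {k} → Fin k → Fin k → Bool
i == j = does (i Fin.≟ j)

==-refl : ∀ {k} (i : Fin k) → i == i ≡ true
==-refl i = dec-true (i Fin.≟ i) refl

==-≢ : ∀ {k} {i j : Fin k} → i ≢ j → i == j ≡ false
==-≢ {i = i} {j} = dec-false (i Fin.≟ j)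

==⇒≡ : ∀ {k} {i j : Fin k} → i == j ≡ true → i ≡ j
==⇒≡ {i = i} {j} i==j with i Fin.≟ j
... | yes i≡j = i≡j

sumℚ-𝟙-== : ∀ {k} (j : Fin k) → sumℚ (λ i → 𝟙 (i == j)) ≡ 1ℚ
sumℚ-𝟙-== j = trans (sumℚ-lookup (λ i → 𝟙 (i == j)) j (λ i i≢j → cong 𝟙 (==-≢ i≢j))) (cong 𝟙 (==-refl j))

sumℚ-𝟙-==-∧ : ∀ {k} (j : Fin k) b → sumℚ (λ i → 𝟙 (i == j ∧ b)) ≡ 𝟙 b
sumℚ-𝟙-==-∧ j true  = trans (sumℚ-cong (λ i → cong 𝟙 (∧-identityʳ (i == j)))) (sumℚ-𝟙-== j)
sumℚ-𝟙-==-∧ j false = sumℚ-zero (λ i → cong 𝟙 (∧-zeroʳ (i == j)))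

sumℚ-𝟙-≠+1 : ∀ {k} (j : Fin k) → sumℚ (λ i → 𝟙 (not (i == j))) + 1ℚ ≡ ℕ→ℚ k
sumℚ-𝟙-≠+1 {k} j = begin
  sumℚ (λ i → 𝟙 (not (i == j))) + 1ℚ                          ≡⟨ cong (sumℚ (λ i → 𝟙 (not (i == j))) +_) (sumℚ-𝟙-== j) ⟨
  sumℚ (λ i → 𝟙 (not (i == j))) + sumℚ (λ i → 𝟙 (i == j))     ≡⟨ sumℚ-distrib-+ (λ i → 𝟙 (not (i == j))) (λ i → 𝟙 (i == j)) ⟨
  sumℚ (λ i → 𝟙 (not (i == j)) + 𝟙 (i == j))                  ≡⟨ sumℚ-cong (λ i → 𝟙-not+𝟙 (i == j)) ⟩
  sumℚ {k} (λ _ → 1ℚ)                                          ≡⟨ sumℚ-const-1 k ⟩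
  ℕ→ℚ k                                                        ∎
  where open ≡-Reasoning

sumℚ²-𝟙-==-∧-== : ∀ {m n} (v : Fin m) (w : Fin n) → sumℚ (λ i → sumℚ (λ j → 𝟙 (i == v ∧ j == w))) ≡ 1ℚ
sumℚ²-𝟙-==-∧-== v w = begin
  sumℚ (λ i → sumℚ (λ j → 𝟙 (i == v ∧ j == w))) ≡⟨ sumℚ-comm (λ i j → 𝟙 (i == v ∧ j == w)) ⟩
  sumℚ (λ j → sumℚ (λ i → 𝟙 (i == v ∧ j == w))) ≡⟨ sumℚ-cong (λ j → sumℚ-𝟙-==-∧ v (j == w)) ⟩
  sumℚ (λ j → 𝟙 (j == w))                       ≡⟨ sumℚ-𝟙-== w ⟩
  1ℚ                                            ∎
  where open ≡-Reasoning

-- Homogeneous linear systems over ℚ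

Annihilates : ∀ {m n} → (Fin m → Fin n → ℚ) → (Fin n → ℚ) → Set
Annihilates A μ = ∀ r → sumℚ (λ i → μ i * A r i) ≡ 0ℚ

NontrivialKernel : ∀ {m n} → (Fin m → Fin n → ℚ) → Set
NontrivialKernel A = ∃[ μ ] Annihilates A μ × ∃[ i ] μ i ≢ 0ℚ

nontrivialKernel-zeroRow : ∀ {m n} (A : Fin (suc m) → Fin (suc n) → ℚ) → (∀ i → A zero i ≡ 0ℚ) →
                           NontrivialKernel (λ r i → A (suc r) (suc i)) → NontrivialKernel A
nontrivialKernel-zeroRow A row₀≡0 (μ , annihilates , i , μi≢0) = μ₀ , annihilates₀ , suc i , μi≢0
  where
  μ₀ : Fin _ → ℚ
  μ₀ zero    = 0ℚ
  μ₀ (suc i) = μ i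
  annihilates₀ : Annihilates A μ₀
  annihilates₀ zero    = sumℚ-zero {f = λ i → μ₀ i * A zero i} λ
    { zero    → *-zeroˡ (A zero zero)
    ; (suc i) → trans (cong (μ i *_) (row₀≡0 (suc i))) (*-zeroʳ (μ i))
    }
  annihilates₀ (suc r) = trans (cong₂ _+_ (*-zeroˡ (A (suc r) zero)) (annihilates r)) (+-identityˡ 0ℚ)

-- One step of Gaussian elimination with pivot A zero j; column j is dropped.
eliminate : ∀ {m n} → (Fin (suc m) → Fin (suc n) → ℚ) → Fin (suc n) → Fin m → Fin n → ℚ
eliminate A j r i = A zero j * A (suc r) (punchIn j i) - A zero (punchIn j i) * A (suc r) j

nontrivialKernel-pivot : ∀ {m n} (A : Fin (suc m) → Fin (suc n) → ℚ) (j : Fin (suc n)) → A zero j ≢ 0ℚ →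
                         NontrivialKernel (eliminate A j) → NontrivialKernel A
nontrivialKernel-pivot A j aj≢0 (μ , annihilates , i , μi≢0) = ν , annihilatesν , punchIn j i , νi≢0
  where
  open ≡-Reasoning
  open +-*-Solver using (solve; _:=_; _:+_; _:*_; :-_; _:-_; con)
  a = A zero
  -- ν is μ scaled by the pivot, with a j-th entry chosen to annihilate row zero.
  νj = - sumℚ (λ i → μ i * a (punchIn j i))
  ν = insertAt (λ i → a j * μ i) j νj
  νi≢0 : ν (punchIn j i) ≢ 0ℚ
  νi≢0 = *-≢0 aj≢0 μi≢0 ∘ trans (sym (insertAt-punchIn _ j νj i))
  expand : ∀ B → sumℚ (λ i → ν i * B i) ≡ νj * B j + a j * sumℚ (λ i → μ i * B (punchIn j i))
  expand B = begin
    sumℚ (λ i → ν i * B i)                                      ≡⟨ sumℚ-remove j (λ i → ν i * B i) ⟩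
    ν j * B j + sumℚ (λ i → ν (punchIn j i) * B (punchIn j i))  ≡⟨ cong₂ _+_ (cong (_* B j) (insertAt-lookup _ j νj)) (sumℚ-cong λ i →
                                                                     trans (cong (_* B (punchIn j i)) (insertAt-punchIn _ j νj i)) (*-assoc (a j) (μ i) _)) ⟩
    νj * B j + sumℚ (λ i → a j * (μ i * B (punchIn j i)))       ≡⟨ cong (νj * B j +_) (*-distribˡ-sumℚ (a j) (λ i → μ i * B (punchIn j i))) ⟨
    νj * B j + a j * sumℚ (λ i → μ i * B (punchIn j i))         ∎
  annihilatesν : Annihilates A ν
  annihilatesν zero = begin
    sumℚ (λ i → ν i * a i)               ≡⟨ expand a ⟩
    νj * a j + a j * S                   ≡⟨ solve 2 (λ x y → :- y :* x :+ x :* y := con 0ℚ) refl (a j) S ⟩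
    0ℚ                                   ∎
    where S = sumℚ (λ i → μ i * a (punchIn j i))
  annihilatesν (suc r) = begin
    sumℚ (λ i → ν i * B i)                               ≡⟨ expand B ⟩
    νj * B j + a j * S₂                                  ≡⟨ solve 4 (λ b s₁ x s₂ → :- s₁ :* b :+ x :* s₂ := x :* s₂ :+ b :* (:- s₁))
                                                              refl (B j) S₁ (a j) S₂ ⟩
    a j * S₂ + B j * - S₁                                ≡⟨ cong₂ _+_ (*-distribˡ-sumℚ (a j) (λ i → μ i * B (punchIn j i)))
                                                                      (trans (cong (B j *_) (sym (sumℚ-neg (λ i → μ i * a (punchIn j i)))))
                                                                             (*-distribˡ-sumℚ (B j) (λ i → - (μ i * a (punchIn j i))))) ⟩
    sumℚ (λ i → a j * (μ i * B (punchIn j i))) + sumℚ (λ i → B j * - (μ i * a (punchIn j i)))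
                                                         ≡⟨ sumℚ-distrib-+ (λ i → a j * (μ i * B (punchIn j i)))
                                                                           (λ i → B j * - (μ i * a (punchIn j i))) ⟨
    sumℚ (λ i → a j * (μ i * B (punchIn j i)) + B j * - (μ i * a (punchIn j i)))
                                                         ≡⟨ sumℚ-cong (λ i → solve 5 (λ m x y z w → x :* (m :* y) :+ w :* (:- (m :* z))
                                                                                                   := m :* (x :* y :- z :* w))
                                                              refl (μ i) (a j) (B (punchIn j i)) (a (punchIn j i)) (B j)) ⟩
    sumℚ (λ i → μ i * eliminate A j r i)                  ≡⟨ annihilates r ⟩
    0ℚ                                                   ∎
    where
    B = A (suc r)
    S₁ = sumℚ (λ i → μ i * a (punchIn j i))
    S₂ = sumℚ (λ i → μ i * B (punchIn j i))

nontrivialKernel : ∀ m (A : Fin m → Fin (suc m) → ℚ) → NontrivialKernel A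
nontrivialKernel zero    A = (λ _ → 1ℚ) , (λ ()) , zero , 1≢0
nontrivialKernel (suc m) A with Fin.all? (λ i → A zero i ≟ 0ℚ)
... | yes row₀≡0 = nontrivialKernel-zeroRow A row₀≡0 (nontrivialKernel m (λ r i → A (suc r) (suc i)))
... | no  row₀≢0 = nontrivialKernel-pivot A j aj≢0 (nontrivialKernel m (eliminate A j))
  where
  pivot = Fin.¬∀⟶∃¬ _ (λ i → A zero i ≡ 0ℚ) (λ i → A zero i ≟ 0ℚ) row₀≢0
  j = proj₁ pivot
  aj≢0 = proj₂ pivot

-- The total matching polytope of a graph

module _ (G : Graph) where
  open Graph G

  nElem : ℕ
  nElem = nV ℕ.+ nE

  elemAt : Fin nElem → Elem G
  elemAt = splitAt nV

  elemAt-injective : ∀ {k l} → elemAt k ≡ elemAt l → k ≡ l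
  elemAt-injective {k} {l} eq = begin
    k                      ≡⟨ Fin.join-splitAt nV nE k ⟨
    Fin.join nV nE (elemAt k) ≡⟨ cong (Fin.join nV nE) eq ⟩
    Fin.join nV nE (elemAt l) ≡⟨ Fin.join-splitAt nV nE l ⟩
    l                      ∎
    where open ≡-Reasoning

  ∀-elemAt : {P : Elem G → Set} → (∀ k → P (elemAt k)) → ∀ c → P c
  ∀-elemAt {P} P-elemAt c = subst P (Fin.splitAt-join nV nE c) (P-elemAt (Fin.join nV nE c))

  _≟ᴱ_ : (c d : Elem G) → Dec (c ≡ d)
  _≟ᴱ_ = ≡-dec Fin._≟_ Fin._≟_

  dot-cong : ∀ a {p q : Point G} → (∀ c → p c ≡ q c) → dot G a p ≡ dot G a q
  dot-cong a p≗q = cong₂ _+_ (sumℚ-cong (λ v → cong (a (inj₁ v) *_) (p≗q (inj₁ v))))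
                             (sumℚ-cong (λ e → cong (a (inj₂ e) *_) (p≗q (inj₂ e))))

  dot-linear : ∀ {k} a (λs : Fin k → ℚ) (q : Fin k → Point G) →
               dot G a (λ c → sumℚ (λ i → λs i * q i c)) ≡ sumℚ (λ i → λs i * dot G a (q i))
  dot-linear a λs q = begin
    dot G a (λ c → sumℚ (λ i → λs i * q i c))                               ≡⟨ cong₂ _+_ (part inj₁) (part inj₂) ⟩
    sumℚ (λ i → λs i * sumℚ (λ v → a (inj₁ v) * q i (inj₁ v)))
      + sumℚ (λ i → λs i * sumℚ (λ e → a (inj₂ e) * q i (inj₂ e)))       ≡⟨ sumℚ-distrib-+ (λ i → λs i * sumℚ (λ v → a (inj₁ v) * q i (inj₁ v)))
                                                                                          (λ i → λs i * sumℚ (λ e → a (inj₂ e) * q i (inj₂ e))) ⟨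
    sumℚ (λ i → λs i * sumℚ (λ v → a (inj₁ v) * q i (inj₁ v))
                + λs i * sumℚ (λ e → a (inj₂ e) * q i (inj₂ e)))          ≡⟨ sumℚ-cong (λ i → *-distribˡ-+ (λs i) _ _) ⟨
    sumℚ (λ i → λs i * dot G a (q i))                                       ∎
    where
    open ≡-Reasoning
    open +-*-Solver using (solve; _:=_; _:*_)
    part : ∀ {m} (ι : Fin m → Elem G) →
           sumℚ (λ v → a (ι v) * sumℚ (λ i → λs i * q i (ι v))) ≡ sumℚ (λ i → λs i * sumℚ (λ v → a (ι v) * q i (ι v)))
    part ι = begin
      sumℚ (λ v → a (ι v) * sumℚ (λ i → λs i * q i (ι v)))   ≡⟨ sumℚ-cong (λ v → *-distribˡ-sumℚ (a (ι v)) (λ i → λs i * q i (ι v))) ⟩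
      sumℚ (λ v → sumℚ (λ i → a (ι v) * (λs i * q i (ι v)))) ≡⟨ sumℚ-comm (λ v i → a (ι v) * (λs i * q i (ι v))) ⟩
      sumℚ (λ i → sumℚ (λ v → a (ι v) * (λs i * q i (ι v)))) ≡⟨ sumℚ-cong (λ i → sumℚ-cong (λ v →
                                                                 solve 3 (λ x y z → x :* (y :* z) := y :* (x :* z)) refl (a (ι v)) (λs i) (q i (ι v)))) ⟩
      sumℚ (λ i → sumℚ (λ v → λs i * (a (ι v) * q i (ι v)))) ≡⟨ sumℚ-cong (λ i → *-distribˡ-sumℚ (λs i) (λ v → a (ι v) * q i (ι v))) ⟨
      sumℚ (λ i → λs i * sumℚ (λ v → a (ι v) * q i (ι v)))   ∎

  InPT-valid : ∀ a b → (∀ T → IsTotalMatching G T → dot G a (χ G T) ≤ b) → ∀ p → InPT G p → dot G a p ≤ b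
  InPT-valid a b valid p (k , T , λs , matching , λs≥0 , Σλs≡1 , p≡Σ) = begin
    dot G a p                           ≡⟨ trans (dot-cong a p≡Σ) (dot-linear a λs (χ G ∘ T)) ⟩
    sumℚ (λ i → λs i * dot G a (χ G (T i))) ≤⟨ sumℚ-mono-≤ (λ i → *-monoˡ-≤-nonNeg (λs i) {{nonNegative (λs≥0 i)}} (valid (T i) (matching i))) ⟩
    sumℚ (λ i → λs i * b)               ≡⟨ trans (sumℚ-cong (λ i → *-comm (λs i) b)) (sym (*-distribˡ-sumℚ b λs)) ⟩
    b * sumℚ λs                         ≡⟨ trans (cong (b *_) Σλs≡1) (*-identityʳ b) ⟩
    b                                   ∎
    where open ≤-Reasoning

  -- Affinity of ψ in the form it is used: ψ respects every affine dependence among points.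
  record IsAffine (ψ : Point G → ℚ) : Set where
    field
      annihilates : ∀ {k} (q : Fin k → Point G) (μ : Fin k → ℚ) → sumℚ μ ≡ 0ℚ →
                    (∀ c → sumℚ (λ i → μ i * q i c) ≡ 0ℚ) → sumℚ (λ i → μ i * ψ (q i)) ≡ 0ℚ
  open IsAffine public

  coord-isAffine : ∀ c → IsAffine (λ p → p c)
  coord-isAffine c .annihilates q μ _ Σμq≡0 = Σμq≡0 c

  const-isAffine : ∀ κ → IsAffine (λ _ → κ)
  const-isAffine κ .annihilates q μ Σμ≡0 _ = begin
    sumℚ (λ i → μ i * κ) ≡⟨ sumℚ-cong (λ i → *-comm (μ i) κ) ⟩
    sumℚ (λ i → κ * μ i) ≡⟨ *-distribˡ-sumℚ κ μ ⟨
    κ * sumℚ μ           ≡⟨ cong (κ *_) Σμ≡0 ⟩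
    κ * 0ℚ               ≡⟨ *-zeroʳ κ ⟩
    0ℚ                   ∎
    where open ≡-Reasoning

  +-isAffine : ∀ {ψ φ} → IsAffine ψ → IsAffine φ → IsAffine (λ p → ψ p + φ p)
  +-isAffine {ψ} {φ} ψ-affine φ-affine .annihilates q μ Σμ≡0 Σμq≡0 = begin
    sumℚ (λ i → μ i * (ψ (q i) + φ (q i)))                 ≡⟨ sumℚ-cong (λ i → *-distribˡ-+ (μ i) (ψ (q i)) (φ (q i))) ⟩
    sumℚ (λ i → μ i * ψ (q i) + μ i * φ (q i))             ≡⟨ sumℚ-distrib-+ (λ i → μ i * ψ (q i)) (λ i → μ i * φ (q i)) ⟩
    sumℚ (λ i → μ i * ψ (q i)) + sumℚ (λ i → μ i * φ (q i)) ≡⟨ cong₂ _+_ (annihilates ψ-affine q μ Σμ≡0 Σμq≡0) (annihilates φ-affine q μ Σμ≡0 Σμq≡0) ⟩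
    0ℚ + 0ℚ                                                ≡⟨ +-identityʳ 0ℚ ⟩
    0ℚ                                                     ∎
    where open ≡-Reasoning

  -‿isAffine : ∀ {ψ} → IsAffine ψ → IsAffine (λ p → - ψ p)
  -‿isAffine {ψ} ψ-affine .annihilates q μ Σμ≡0 Σμq≡0 = begin
    sumℚ (λ i → μ i * - ψ (q i))   ≡⟨ sumℚ-cong (λ i → neg-distribʳ-* (μ i) (ψ (q i))) ⟨
    sumℚ (λ i → - (μ i * ψ (q i))) ≡⟨ sumℚ-neg (λ i → μ i * ψ (q i)) ⟩
    - sumℚ (λ i → μ i * ψ (q i))   ≡⟨ cong -_ (annihilates ψ-affine q μ Σμ≡0 Σμq≡0) ⟩
    0ℚ                             ∎
    where open ≡-Reasoning

  sum-isAffine : ∀ {m} {ψ : Fin m → Point G → ℚ} → (∀ j → IsAffine (ψ j)) → IsAffine (λ p → sumℚ (λ j → ψ j p))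
  sum-isAffine {ψ = ψ} ψ-affine .annihilates q μ Σμ≡0 Σμq≡0 = begin
    sumℚ (λ i → μ i * sumℚ (λ j → ψ j (q i)))   ≡⟨ sumℚ-cong (λ i → *-distribˡ-sumℚ (μ i) (λ j → ψ j (q i))) ⟩
    sumℚ (λ i → sumℚ (λ j → μ i * ψ j (q i)))   ≡⟨ sumℚ-comm (λ i j → μ i * ψ j (q i)) ⟩
    sumℚ (λ j → sumℚ (λ i → μ i * ψ j (q i)))   ≡⟨ sumℚ-zero {f = λ j → sumℚ (λ i → μ i * ψ j (q i))} (λ j → annihilates (ψ-affine j) q μ Σμ≡0 Σμq≡0) ⟩
    0ℚ                                          ∎
    where open ≡-Reasoning

  affInd-unitriangular : ∀ {k} (p : Fin k → Point G) (ψ : Fin k → Point G → ℚ) (rank : Fin k → ℕ) →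
                         (∀ i → IsAffine (ψ i)) → (∀ i → ψ i (p i) ≡ 1ℚ) →
                         (∀ i j → j ≢ i → rank i ℕ.≤ rank j → ψ i (p j) ≡ 0ℚ) → AffInd G p
  affInd-unitriangular p ψ rank affine diag upper μ Σμ≡0 Σμp≡0 i = μ≡0-below (suc (rank i)) i ℕ.≤-refl
    where
    μ≡0-below : ∀ n i → rank i ℕ.< n → μ i ≡ 0ℚ
    μ≡0-below (suc n) i (s≤s rank-i≤n) = begin
      μ i                          ≡⟨ trans (cong (μ i *_) (diag i)) (*-identityʳ (μ i)) ⟨
      μ i * ψ i (p i)              ≡⟨ sumℚ-lookup (λ j → μ j * ψ i (p j)) i off-diagonal ⟨
      sumℚ (λ j → μ j * ψ i (p j)) ≡⟨ annihilates (affine i) p μ Σμ≡0 Σμp≡0 ⟩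
      0ℚ                           ∎
      where
      open ≡-Reasoning
      off-diagonal : ∀ j → j ≢ i → μ j * ψ i (p j) ≡ 0ℚ
      off-diagonal j j≢i with rank j ℕ.<? rank i
      ... | yes rank-j<i = trans (cong (_* ψ i (p j)) (μ≡0-below n j (ℕ.<-≤-trans rank-j<i rank-i≤n))) (*-zeroˡ (ψ i (p j)))
      ... | no  rank-j≮i = trans (cong (μ j *_) (upper i j j≢i (ℕ.≮⇒≥ rank-j≮i))) (*-zeroʳ (μ j))

  χ-inPT : ∀ T → IsTotalMatching G T → InPT G (χ G T)
  χ-inPT T matching = 1 , (λ _ → T) , (λ _ → 1ℚ) , (λ _ → matching) , (λ _ → ℕ→ℚ-nonNeg 1) , +-identityʳ 1ℚ ,
                      (λ c → sym (trans (+-identityʳ _) (*-identityˡ _)))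

  ∅-isTotalMatching : IsTotalMatching G (λ _ → false)
  ∅-isTotalMatching _ _ ()

  singleton : Elem G → Elem G → Bool
  singleton c d = does (d ≟ᴱ c)

  singleton-isTotalMatching : ∀ c → IsTotalMatching G (singleton c)
  singleton-isTotalMatching c d d′ d∈ d′∈ d≢d′ _ with d ≟ᴱ c | d′ ≟ᴱ c
  ... | yes refl | yes refl = d≢d′ refl

  χ-singleton-self : ∀ c → χ G (singleton c) c ≡ 1ℚ
  χ-singleton-self c with c ≟ᴱ c
  ... | yes _   = refl
  ... | no  c≢c = ⊥-elim (c≢c refl)

  χ-singleton-other : ∀ {c d} → d ≢ c → χ G (singleton c) d ≡ 0ℚ
  χ-singleton-other {c} {d} d≢c with d ≟ᴱ c
  ... | yes d≡c = ⊥-elim (d≢c d≡c)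
  ... | no  _   = refl

  basicPoint : Fin (suc nElem) → Point G
  basicPoint zero    = χ G (λ _ → false)
  basicPoint (suc k) = χ G (singleton (elemAt k))

  basicPoint-inPT : ∀ i → InPT G (basicPoint i)
  basicPoint-inPT zero    = χ-inPT _ ∅-isTotalMatching
  basicPoint-inPT (suc k) = χ-inPT _ (singleton-isTotalMatching (elemAt k))

  basicPoint-affInd : AffInd G basicPoint
  basicPoint-affInd = affInd-unitriangular basicPoint ψ rank affine diag upper
    where
    ψ : Fin (suc nElem) → Point G → ℚ
    ψ zero    _ = 1ℚ
    ψ (suc k) p = p (elemAt k)
    rank : Fin (suc nElem) → ℕ
    rank zero    = 1
    rank (suc _) = 0
    affine : ∀ i → IsAffine (ψ i)
    affine zero    = const-isAffine 1ℚ
    affine (suc k) = coord-isAffine (elemAt k)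
    diag : ∀ i → ψ i (basicPoint i) ≡ 1ℚ
    diag zero    = refl
    diag (suc k) = χ-singleton-self (elemAt k)
    upper : ∀ i j → j ≢ i → rank i ℕ.≤ rank j → ψ i (basicPoint j) ≡ 0ℚ
    upper zero    zero    j≢i _ = ⊥-elim (j≢i refl)
    upper (suc k) zero    _   _ = refl
    upper (suc k) (suc l) l≢k _ = χ-singleton-other (l≢k ∘ cong suc ∘ elemAt-injective ∘ sym)

  affDependent : (q : Fin (suc (suc nElem)) → Point G) → ¬ AffInd G q
  affDependent q independent = μi≢0 (independent μ Σμ≡0 (∀-elemAt (μ⊥A ∘ suc)) i)
    where
    A : Fin (suc nElem) → Fin (suc (suc nElem)) → ℚ
    A zero    _ = 1ℚ
    A (suc m) i = q i (elemAt m)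
    kernel = nontrivialKernel (suc nElem) A
    μ = proj₁ kernel
    μ⊥A = proj₁ (proj₂ kernel)
    i = proj₁ (proj₂ (proj₂ kernel))
    μi≢0 = proj₂ (proj₂ (proj₂ kernel))
    Σμ≡0 : sumℚ μ ≡ 0ℚ
    Σμ≡0 = trans (sumℚ-cong (λ i → sym (*-identityʳ (μ i)))) (μ⊥A zero)

  -- As b ≠ 0, a linear dependence among points of the hyperplane is already affine.
  hyperplane-affDependent : ∀ a b → b ≢ 0ℚ → (q : Fin (suc nElem) → Point G) →
                            (∀ i → dot G a (q i) ≡ b) → ¬ AffInd G q
  hyperplane-affDependent a b b≢0 q on-hyperplane independent =
    μi≢0 (independent μ (*-cancelˡ-≡0 b≢0 b*Σμ≡0) (∀-elemAt μ⊥A) i)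
    where
    kernel = nontrivialKernel nElem (λ m i → q i (elemAt m))
    μ = proj₁ kernel
    μ⊥A = proj₁ (proj₂ kernel)
    i = proj₁ (proj₂ (proj₂ kernel))
    μi≢0 = proj₂ (proj₂ (proj₂ kernel))
    b*Σμ≡0 : b * sumℚ μ ≡ 0ℚ
    b*Σμ≡0 = begin
      b * sumℚ μ                                ≡⟨ *-distribˡ-sumℚ b μ ⟩
      sumℚ (λ i → b * μ i)                      ≡⟨ sumℚ-cong (λ i → trans (*-comm b (μ i)) (cong (μ i *_) (sym (on-hyperplane i)))) ⟩
      sumℚ (λ i → μ i * dot G a (q i))          ≡⟨ dot-linear a μ q ⟨
      dot G a (λ c → sumℚ (λ i → μ i * q i c))  ≡⟨ dot-cong a (∀-elemAt {P = λ c → sumℚ (λ i → μ i * q i c) ≡ 0ℚ} μ⊥A) ⟩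
      dot G a (λ _ → 0ℚ)                        ≡⟨ cong₂ _+_ (sumℚ-zero {f = λ v → a (inj₁ v) * 0ℚ} (λ v → *-zeroʳ (a (inj₁ v))))
                                                             (sumℚ-zero {f = λ e → a (inj₂ e) * 0ℚ} (λ e → *-zeroʳ (a (inj₂ e)))) ⟩
      0ℚ + 0ℚ                                   ≡⟨ +-identityʳ 0ℚ ⟩
      0ℚ                                        ∎
      where open ≡-Reasoning

  PT-affRank : HasAffRank G (InPT G) (suc nElem)
  PT-affRank = (basicPoint , basicPoint-inPT , basicPoint-affInd) , (λ q _ → affDependent q)

  definesFacet : ∀ a b → b ≢ 0ℚ → (∀ T → IsTotalMatching G T → dot G a (χ G T) ≤ b) →
                 (p : Fin nElem → Point G) → (∀ k → InPT G (p k) × dot G a (p k) ≡ b) → AffInd G p →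
                 DefinesFacet G a b
  definesFacet a b b≢0 valid p tight independent =
    InPT-valid a b valid , nElem , PT-affRank ,
    ((p , tight , independent) , λ q q-tight → hyperplane-affDependent a b b≢0 q (proj₂ ∘ q-tight))

-- The complete bipartite graph K_{r,s}

module _ {r s : ℕ} where

  vertexR : Fin r → Elem (K r s)
  vertexR i = inj₁ (i ↑ˡ s)

  vertexS : Fin s → Elem (K r s)
  vertexS j = inj₁ (r ↑ʳ j)

  edge : Fin r → Fin s → Elem (K r s)
  edge i j = inj₂ (combine i j)

  data ElemView : Elem (K r s) → Set where
    R-vertex : ∀ i → ElemView (vertexR i)
    S-vertex : ∀ j → ElemView (vertexS j)
    RS-edge  : ∀ i j → ElemView (edge i j)

  elemView : ∀ c → ElemView c
  elemView (inj₁ u) with splitAt r u in eq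
  ... | inj₁ i = subst ElemView (cong inj₁ (Fin.splitAt⁻¹-↑ˡ eq)) (R-vertex i)
  ... | inj₂ j = subst ElemView (cong inj₁ (Fin.splitAt⁻¹-↑ʳ eq)) (S-vertex j)
  elemView (inj₂ e) = subst ElemView (cong inj₂ (Fin.combine-remQuot {r} s e)) (RS-edge _ _)

  ↑ˡ≢↑ʳ : ∀ (i : Fin r) (j : Fin s) → i ↑ˡ s ≢ r ↑ʳ j
  ↑ˡ≢↑ʳ i j eq with trans (sym (Fin.splitAt-↑ˡ r i s)) (trans (cong (splitAt r) eq) (Fin.splitAt-↑ʳ r s j))
  ... | ()

  ends-edge : ∀ i j → Graph.ends (K r s) (combine i j) ≡ (i ↑ˡ s , r ↑ʳ j)
  ends-edge i j = cong (λ ij → proj₁ ij ↑ˡ s , r ↑ʳ proj₂ ij) (Fin.remQuot-combine i j)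

  incident-edge : ∀ u i j → Incident (K r s) u (combine i j) → u ≡ i ↑ˡ s ⊎ u ≡ r ↑ʳ j
  incident-edge u i j (inj₁ eq) = inj₁ (trans (sym eq) (cong proj₁ (ends-edge i j)))
  incident-edge u i j (inj₂ eq) = inj₂ (trans (sym eq) (cong proj₂ (ends-edge i j)))

  record Selection : Set where
    field
      inR : Fin r → Bool
      inS : Fin s → Bool
      inE : Fin r → Fin s → Bool
  open Selection public

  toSubset : Selection → Elem (K r s) → Bool
  toSubset σ (inj₁ u) = [ inR σ , inS σ ]′ (splitAt r u)
  toSubset σ (inj₂ e) = uncurry (inE σ) (remQuot s e)

  ofSubset : (Elem (K r s) → Bool) → Selection
  ofSubset T = record { inR = T ∘ vertexR ; inS = T ∘ vertexS ; inE = λ i j → T (edge i j) }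

  toSubset-vertexR : ∀ σ i → toSubset σ (vertexR i) ≡ inR σ i
  toSubset-vertexR σ i = cong [ inR σ , inS σ ]′ (Fin.splitAt-↑ˡ r i s)

  toSubset-vertexS : ∀ σ j → toSubset σ (vertexS j) ≡ inS σ j
  toSubset-vertexS σ j = cong [ inR σ , inS σ ]′ (Fin.splitAt-↑ʳ r s j)

  toSubset-edge : ∀ σ i j → toSubset σ (edge i j) ≡ inE σ i j
  toSubset-edge σ i j = cong (uncurry (inE σ)) (Fin.remQuot-combine i j)

  record IsIndependent (σ : Selection) : Set where
    field
      R-S  : ∀ i j → inR σ i ≡ true → inS σ j ≡ true → ⊥
      R-E  : ∀ i j → inR σ i ≡ true → inE σ i j ≡ true → ⊥
      S-E  : ∀ i j → inS σ j ≡ true → inE σ i j ≡ true → ⊥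
      E-Eˡ : ∀ i j j′ → inE σ i j ≡ true → inE σ i j′ ≡ true → j ≡ j′
      E-Eʳ : ∀ i i′ j → inE σ i j ≡ true → inE σ i′ j ≡ true → i ≡ i′

  isTotalMatching⇒isIndependent : ∀ {T} → IsTotalMatching (K r s) T → IsIndependent (ofSubset T)
  isTotalMatching⇒isIndependent matching = record
    { R-S  = λ i j x∈ w∈ → matching _ _ x∈ w∈ (↑ˡ≢↑ʳ i j ∘ inj₁-injective) (combine i j , inj₁ (ends-edge i j))
    ; R-E  = λ i j x∈ y∈ → matching _ _ x∈ y∈ (λ ()) (inj₁ (cong proj₁ (ends-edge i j)))
    ; S-E  = λ i j w∈ y∈ → matching _ _ w∈ y∈ (λ ()) (inj₂ (cong proj₂ (ends-edge i j)))
    ; E-Eˡ = λ i j j′ y∈ y′∈ → decidable-stable (j Fin.≟ j′) λ j≢j′ →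
               matching _ _ y∈ y′∈ (j≢j′ ∘ edge-injectiveʳ) (i ↑ˡ s , inj₁ (cong proj₁ (ends-edge i j)) , inj₁ (cong proj₁ (ends-edge i j′)))
    ; E-Eʳ = λ i i′ j y∈ y′∈ → decidable-stable (i Fin.≟ i′) λ i≢i′ →
               matching _ _ y∈ y′∈ (i≢i′ ∘ edge-injectiveˡ) (r ↑ʳ j , inj₂ (cong proj₂ (ends-edge i j)) , inj₂ (cong proj₂ (ends-edge i′ j)))
    }
    where
    edge-injectiveˡ : ∀ {i i′ j j′} → edge i j ≡ edge i′ j′ → i ≡ i′
    edge-injectiveˡ {i} {i′} {j} {j′} = proj₁ ∘ Fin.combine-injective i j i′ j′ ∘ inj₂-injective
    edge-injectiveʳ : ∀ {i i′ j j′} → edge i j ≡ edge i′ j′ → j ≡ j′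
    edge-injectiveʳ {i} {i′} {j} {j′} = proj₂ ∘ Fin.combine-injective i j i′ j′ ∘ inj₂-injective

  isIndependent⇒isTotalMatching : ∀ {σ} → IsIndependent σ → IsTotalMatching (K r s) (toSubset σ)
  isIndependent⇒isTotalMatching {σ} independent a b = nonAdjacent (elemView a) (elemView b)
    where
    open IsIndependent independent
    R∈ : ∀ {i} → toSubset σ (vertexR i) ≡ true → inR σ i ≡ true
    R∈ {i} = trans (sym (toSubset-vertexR σ i))
    S∈ : ∀ {j} → toSubset σ (vertexS j) ≡ true → inS σ j ≡ true
    S∈ {j} = trans (sym (toSubset-vertexS σ j))
    E∈ : ∀ {i j} → toSubset σ (edge i j) ≡ true → inE σ i j ≡ true
    E∈ {i} {j} = trans (sym (toSubset-edge σ i j))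
    R-E-incident : ∀ i i′ j → Incident (K r s) (i ↑ˡ s) (combine i′ j) → inR σ i ≡ true → inE σ i′ j ≡ true → ⊥
    R-E-incident i i′ j incident x∈ y∈ with incident-edge _ i′ j incident
    ... | inj₁ eq rewrite Fin.↑ˡ-injective s i i′ eq = R-E i′ j x∈ y∈
    ... | inj₂ eq = ↑ˡ≢↑ʳ i j eq
    S-E-incident : ∀ j i j′ → Incident (K r s) (r ↑ʳ j) (combine i j′) → inS σ j ≡ true → inE σ i j′ ≡ true → ⊥
    S-E-incident j i j′ incident w∈ y∈ with incident-edge _ i j′ incident
    ... | inj₁ eq = ↑ˡ≢↑ʳ i j (sym eq)
    ... | inj₂ eq rewrite Fin.↑ʳ-injective r j j′ eq = S-E i j′ w∈ y∈
    nonAdjacent : ∀ {a b} → ElemView a → ElemView b →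
                  toSubset σ a ≡ true → toSubset σ b ≡ true → a ≢ b → ¬ Adjacent (K r s) a b
    nonAdjacent (R-vertex i) (R-vertex i′) _ _ _ (_ , inj₁ eq) = ↑ˡ≢↑ʳ i′ _ (sym (cong proj₂ eq))
    nonAdjacent (R-vertex i) (R-vertex i′) _ _ _ (_ , inj₂ eq) = ↑ˡ≢↑ʳ i _ (sym (cong proj₂ eq))
    nonAdjacent (R-vertex i) (S-vertex j) a∈ b∈ _ _ = R-S i j (R∈ a∈) (S∈ b∈)
    nonAdjacent (R-vertex i) (RS-edge i′ j) a∈ b∈ _ incident = R-E-incident i i′ j incident (R∈ a∈) (E∈ b∈)
    nonAdjacent (S-vertex j) (R-vertex i) a∈ b∈ _ _ = R-S i j (R∈ b∈) (S∈ a∈)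
    nonAdjacent (S-vertex j) (S-vertex j′) _ _ _ (_ , inj₁ eq) = ↑ˡ≢↑ʳ _ j (cong proj₁ eq)
    nonAdjacent (S-vertex j) (S-vertex j′) _ _ _ (_ , inj₂ eq) = ↑ˡ≢↑ʳ _ j′ (cong proj₁ eq)
    nonAdjacent (S-vertex j) (RS-edge i j′) a∈ b∈ _ incident = S-E-incident j i j′ incident (S∈ a∈) (E∈ b∈)
    nonAdjacent (RS-edge i j) (R-vertex i′) a∈ b∈ _ incident = R-E-incident i′ i j incident (R∈ b∈) (E∈ a∈)
    nonAdjacent (RS-edge i j) (S-vertex j′) a∈ b∈ _ incident = S-E-incident j′ i j incident (S∈ b∈) (E∈ a∈)
    nonAdjacent (RS-edge i j) (RS-edge i′ j′) a∈ b∈ a≢b (u , incident , incident′)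
      with incident-edge u i j incident | incident-edge u i′ j′ incident′
    ... | inj₁ refl | inj₂ eq = ↑ˡ≢↑ʳ i j′ eq
    ... | inj₂ refl | inj₁ eq = ↑ˡ≢↑ʳ i′ j (sym eq)
    ... | inj₁ refl | inj₁ eq with Fin.↑ˡ-injective s i i′ eq
    ...   | refl with E-Eˡ i j j′ (E∈ a∈) (E∈ b∈)
    ...     | refl = a≢b refl
    nonAdjacent (RS-edge i j) (RS-edge i′ j′) a∈ b∈ a≢b (u , incident , incident′)
        | inj₂ refl | inj₂ eq with Fin.↑ʳ-injective r j j′ eq
    ...   | refl with E-Eʳ i i′ j (E∈ a∈) (E∈ b∈)
    ...     | refl = a≢b refl

  ⟪_⟫ : Selection → Point (K r s)
  ⟪ σ ⟫ = χ (K r s) (toSubset σ)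

  ⟪⟫-vertexR : ∀ σ i → ⟪ σ ⟫ (vertexR i) ≡ 𝟙 (inR σ i)
  ⟪⟫-vertexR σ i = cong 𝟙 (toSubset-vertexR σ i)

  ⟪⟫-vertexS : ∀ σ j → ⟪ σ ⟫ (vertexS j) ≡ 𝟙 (inS σ j)
  ⟪⟫-vertexS σ j = cong 𝟙 (toSubset-vertexS σ j)

  ⟪⟫-edge : ∀ σ i j → ⟪ σ ⟫ (edge i j) ≡ 𝟙 (inE σ i j)
  ⟪⟫-edge σ i j = cong 𝟙 (toSubset-edge σ i j)

  allR : Selection
  allR = record { inR = λ _ → true ; inS = λ _ → false ; inE = λ _ _ → false }

  allS : Selection
  allS = record { inR = λ _ → false ; inS = λ _ → true ; inE = λ _ _ → false }

  R-swap : Fin r → Fin s → Selection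
  R-swap v w = record { inR = λ i → not (i == v) ; inS = λ _ → false ; inE = λ i j → i == v ∧ j == w }

  S-swap : Fin r → Fin s → Selection
  S-swap v w = record { inR = λ _ → false ; inS = λ j → not (j == w) ; inE = λ i j → i == v ∧ j == w }

  allR-isIndependent : IsIndependent allR
  allR-isIndependent = record
    { R-S = λ { _ _ _ () } ; R-E = λ { _ _ _ () } ; S-E = λ { _ _ () _ } ; E-Eˡ = λ { _ _ _ () _ } ; E-Eʳ = λ { _ _ _ () _ } }

  allS-isIndependent : IsIndependent allS
  allS-isIndependent = record
    { R-S = λ { _ _ () _ } ; R-E = λ { _ _ () _ } ; S-E = λ { _ _ _ () } ; E-Eˡ = λ { _ _ _ () _ } ; E-Eʳ = λ { _ _ _ () _ } }

  private
    ==-∧-==⇒≡ : ∀ {i v : Fin r} {j w : Fin s} → i == v ∧ j == w ≡ true → i ≡ v × j ≡ w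
    ==-∧-==⇒≡ {i} {v} y∈ with i == v in i==v
    ... | true = ==⇒≡ i==v , ==⇒≡ y∈

    not-==-∧ : ∀ {m n} {i v : Fin m} {j w : Fin n} → not (i == v) ≡ true → i == v ∧ j == w ≡ true → ⊥
    not-==-∧ {i = i} {v = v} i∉ y∈ with i == v
    not-==-∧ () _ | true

  R-swap-isIndependent : ∀ v w → IsIndependent (R-swap v w)
  R-swap-isIndependent v w = record
    { R-S  = λ _ _ _ ()
    ; R-E  = λ i j → not-==-∧ {i = i} {v} {j} {w}
    ; S-E  = λ _ _ ()
    ; E-Eˡ = λ i j j′ y∈ y′∈ → trans (proj₂ (==-∧-==⇒≡ {i} {v} {j} y∈)) (sym (proj₂ (==-∧-==⇒≡ {i} {v} {j′} y′∈)))
    ; E-Eʳ = λ i i′ j y∈ y′∈ → trans (proj₁ (==-∧-==⇒≡ {i} {v} {j} y∈)) (sym (proj₁ (==-∧-==⇒≡ {i′} {v} {j} y′∈)))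
    }

  S-swap-isIndependent : ∀ v w → IsIndependent (S-swap v w)
  S-swap-isIndependent v w = record
    { R-S  = λ _ _ ()
    ; R-E  = λ _ _ ()
    ; S-E  = λ i j w∉ y∈ → not-==-∧ {i = j} {w} {i} {v} w∉ (trans (∧-comm (j == w) (i == v)) y∈)
    ; E-Eˡ = λ i j j′ y∈ y′∈ → trans (proj₂ (==-∧-==⇒≡ {i} {v} {j} y∈)) (sym (proj₂ (==-∧-==⇒≡ {i} {v} {j′} y′∈)))
    ; E-Eʳ = λ i i′ j y∈ y′∈ → trans (proj₁ (==-∧-==⇒≡ {i} {v} {j} y∈)) (sym (proj₁ (==-∧-==⇒≡ {i′} {v} {j} y′∈)))
    }

-- The lifted biclique inequality

m∸[n∸1]≡1+[m∸n] : ∀ {m n} → 1 ℕ.≤ n → n ℕ.≤ m → m ∸ (n ∸ 1) ≡ suc (m ∸ n)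
m∸[n∸1]≡1+[m∸n] {suc m} {suc n} _ (s≤s n≤m) = ℕ.+-∸-assoc 1 n≤m

module _ {r s : ℕ} (t : Fin r) (r≤s : r ℕ.≤ s) where

  private
    d : ℕ
    d = s ∸ r
    vR : Fin r → Elem (K r s)
    vR = vertexR
    vS : Fin s → Elem (K r s)
    vS = vertexS
    e : Fin r → Fin s → Elem (K r s)
    e = edge
    Sel : Set
    Sel = Selection {r} {s}

  ℕ→ℚ-s : ℕ→ℚ s ≡ ℕ→ℚ r + ℕ→ℚ d
  ℕ→ℚ-s = trans (cong ℕ→ℚ (sym (ℕ.m+[n∸m]≡n r≤s))) (ℕ→ℚ-+ r d)

  liftedBiclique-vertexR : ∀ i → liftedBiclique r s t (vR i) ≡ 1ℚ + ℕ→ℚ d * 𝟙 (i == t)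
  liftedBiclique-vertexR i rewrite Fin.splitAt-↑ˡ r i s with i Fin.≟ t
  ... | yes _ = begin
    ℕ→ℚ (s ∸ (r ∸ 1))  ≡⟨ cong ℕ→ℚ (m∸[n∸1]≡1+[m∸n] (ℕ.≤-trans (s≤s z≤n) (Fin.toℕ<n t)) r≤s) ⟩
    ℕ→ℚ (suc d)        ≡⟨ ℕ→ℚ-suc d ⟩
    1ℚ + ℕ→ℚ d         ≡⟨ cong (1ℚ +_) (*-identityʳ (ℕ→ℚ d)) ⟨
    1ℚ + ℕ→ℚ d * 1ℚ    ∎
    where open ≡-Reasoning
  ... | no  _ = sym (trans (cong (1ℚ +_) (*-zeroʳ (ℕ→ℚ d))) (+-identityʳ 1ℚ))

  liftedBiclique-vertexS : ∀ j → liftedBiclique r s t (vS j) ≡ 1ℚ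
  liftedBiclique-vertexS j rewrite Fin.splitAt-↑ʳ r s j = refl

  weight : (Fin r → ℚ) → (Fin s → ℚ) → (Fin r → Fin s → ℚ) → ℚ
  weight x w y = ((sumℚ x + ℕ→ℚ d * x t) + sumℚ w) + sumℚ (λ i → sumℚ (y i))

  sumℚ-liftedBiclique-R : ∀ x → sumℚ (λ i → liftedBiclique r s t (vR i) * x i) ≡ sumℚ x + ℕ→ℚ d * x t
  sumℚ-liftedBiclique-R x = begin
    sumℚ (λ i → liftedBiclique r s t (vR i) * x i)            ≡⟨ sumℚ-cong (λ i → trans (cong (_* x i) (liftedBiclique-vertexR i))
                                                                                         (*-distribʳ-+ (x i) 1ℚ (ℕ→ℚ d * 𝟙 (i == t)))) ⟩
    sumℚ (λ i → 1ℚ * x i + ℕ→ℚ d * 𝟙 (i == t) * x i)         ≡⟨ sumℚ-distrib-+ (λ i → 1ℚ * x i) (λ i → ℕ→ℚ d * 𝟙 (i == t) * x i) ⟩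
    sumℚ (λ i → 1ℚ * x i) + sumℚ (λ i → ℕ→ℚ d * 𝟙 (i == t) * x i)
                                                              ≡⟨ cong₂ _+_ (sumℚ-cong (λ i → *-identityˡ (x i)))
                                                                           (sumℚ-lookup (λ i → ℕ→ℚ d * 𝟙 (i == t) * x i) t off-t) ⟩
    sumℚ x + ℕ→ℚ d * 𝟙 (t == t) * x t                          ≡⟨ cong (λ b → sumℚ x + ℕ→ℚ d * 𝟙 b * x t) (==-refl t) ⟩
    sumℚ x + ℕ→ℚ d * 1ℚ * x t                                  ≡⟨ cong (λ z → sumℚ x + z * x t) (*-identityʳ (ℕ→ℚ d)) ⟩
    sumℚ x + ℕ→ℚ d * x t                                       ∎
    where
    open ≡-Reasoning
    off-t : ∀ i → i ≢ t → ℕ→ℚ d * 𝟙 (i == t) * x i ≡ 0ℚ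
    off-t i i≢t = begin
      ℕ→ℚ d * 𝟙 (i == t) * x i  ≡⟨ cong (λ b → ℕ→ℚ d * 𝟙 b * x i) (==-≢ i≢t) ⟩
      ℕ→ℚ d * 0ℚ * x i          ≡⟨ cong (_* x i) (*-zeroʳ (ℕ→ℚ d)) ⟩
      0ℚ * x i                  ≡⟨ *-zeroˡ (x i) ⟩
      0ℚ                        ∎

  dot-liftedBiclique : ∀ p → dot (K r s) (liftedBiclique r s t) p ≡ weight (p ∘ vR) (p ∘ vS) (λ i j → p (e i j))
  dot-liftedBiclique p = begin
    dot (K r s) a p                                                   ≡⟨ cong₂ _+_ (sumℚ-splitAt r (λ u → a (inj₁ u) * p (inj₁ u)))
                                                                                  (trans (sumℚ-cong (λ k → *-identityˡ (p (inj₂ k)))) (sumℚ-combine r (λ k → p (inj₂ k)))) ⟩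
    (sumℚ (λ i → a (vR i) * p (vR i)) + sumℚ (λ j → a (vS j) * p (vS j)))
      + sumℚ (λ i → sumℚ (λ j → p (e i j)))                          ≡⟨ cong (_+ sumℚ (λ i → sumℚ (λ j → p (e i j))))
                                                                          (cong₂ _+_ (sumℚ-liftedBiclique-R (p ∘ vR))
                                                                                     (sumℚ-cong (λ j → trans (cong (_* p (vS j)) (liftedBiclique-vertexS j)) (*-identityˡ (p (vS j)))))) ⟩
    weight (p ∘ vR) (p ∘ vS) (λ i j → p (e i j))                      ∎
    where
    open ≡-Reasoning
    a = liftedBiclique r s t

  liftedBiclique-valid : ∀ T → IsTotalMatching (K r s) T → dot (K r s) (liftedBiclique r s t) (χ (K r s) T) ≤ ℕ→ℚ s
  liftedBiclique-valid T matching = ≤-trans (≤-reflexive (dot-liftedBiclique (χ (K r s) T))) weight≤s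
    where
    open IsIndependent (isTotalMatching⇒isIndependent matching)
    open +-*-Solver using (solve; _:=_; _:+_; _:*_; con)
    open ≤-Reasoning
    x = 𝟙 ∘ T ∘ vR
    w = 𝟙 ∘ T ∘ vS
    y = λ i j → 𝟙 (T (e i j))
    Σy = sumℚ (λ i → sumℚ (y i))
    row≤1 : ∀ i → x i + sumℚ (y i) ≤ 1ℚ
    row≤1 i = 𝟙+sumℚ-𝟙-≤1 _ _ (R-E i) (E-Eˡ i)
    column≤1 : ∀ j → w j + sumℚ (λ i → y i j) ≤ 1ℚ
    column≤1 j = 𝟙+sumℚ-𝟙-≤1 _ _ (λ i → S-E i j) (λ i i′ → E-Eʳ i i′ j)
    weight≤s : weight x w y ≤ ℕ→ℚ s
    weight≤s with Fin.any? (λ i → T (vR i) Bool.≟ true)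
    ... | yes (i₀ , x∈) = begin
      ((sumℚ x + ℕ→ℚ d * x t) + sumℚ w) + Σy  ≡⟨ cong (λ z → ((sumℚ x + ℕ→ℚ d * x t) + z) + Σy)
                                                      (sumℚ-zero (λ j → cong 𝟙 (¬-not (R-S i₀ j x∈)))) ⟩
      ((sumℚ x + ℕ→ℚ d * x t) + 0ℚ) + Σy       ≡⟨ solve 3 (λ X Y Z → ((X :+ Y) :+ con 0ℚ) :+ Z := (X :+ Z) :+ Y) refl (sumℚ x) (ℕ→ℚ d * x t) Σy ⟩
      (sumℚ x + Σy) + ℕ→ℚ d * x t               ≡⟨ cong (_+ ℕ→ℚ d * x t) (sumℚ-distrib-+ x (λ i → sumℚ (y i))) ⟨
      sumℚ (λ i → x i + sumℚ (y i)) + ℕ→ℚ d * x t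
                                               ≤⟨ +-mono-≤ (sumℚ-mono-≤ row≤1) (*-monoˡ-≤-nonNeg (ℕ→ℚ d) {{nonNegative (ℕ→ℚ-nonNeg d)}} (𝟙≤1 _)) ⟩
      sumℚ {r} (λ _ → 1ℚ) + ℕ→ℚ d * 1ℚ          ≡⟨ cong₂ _+_ (sumℚ-const-1 r) (*-identityʳ (ℕ→ℚ d)) ⟩
      ℕ→ℚ r + ℕ→ℚ d                             ≡⟨ ℕ→ℚ-s ⟨
      ℕ→ℚ s                                     ∎
    ... | no  R∩T≡∅ = begin
      ((sumℚ x + ℕ→ℚ d * x t) + sumℚ w) + Σy   ≡⟨ cong₂ (λ X Y → ((X + ℕ→ℚ d * Y) + sumℚ w) + Σy) (sumℚ-zero x≡0) (x≡0 t) ⟩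
      ((0ℚ + ℕ→ℚ d * 0ℚ) + sumℚ w) + Σy        ≡⟨ solve 3 (λ D W Z → ((con 0ℚ :+ D :* con 0ℚ) :+ W) :+ Z := W :+ Z) refl (ℕ→ℚ d) (sumℚ w) Σy ⟩
      sumℚ w + Σy                              ≡⟨ cong (sumℚ w +_) (sumℚ-comm y) ⟩
      sumℚ w + sumℚ (λ j → sumℚ (λ i → y i j)) ≡⟨ sumℚ-distrib-+ w (λ j → sumℚ (λ i → y i j)) ⟨
      sumℚ (λ j → w j + sumℚ (λ i → y i j))    ≤⟨ sumℚ-mono-≤ column≤1 ⟩
      sumℚ {s} (λ _ → 1ℚ)                      ≡⟨ sumℚ-const-1 s ⟩
      ℕ→ℚ s                                    ∎
      where
      x≡0 : ∀ i → x i ≡ 0ℚ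
      x≡0 i = cong 𝟙 (¬-not (λ x∈ → R∩T≡∅ (i , x∈)))

  selectionWeight : Sel → ℚ
  selectionWeight σ = weight (𝟙 ∘ inR σ) (𝟙 ∘ inS σ) (λ i j → 𝟙 (inE σ i j))

  dot-liftedBiclique-⟪⟫ : ∀ σ → dot (K r s) (liftedBiclique r s t) ⟪ σ ⟫ ≡ selectionWeight σ
  dot-liftedBiclique-⟪⟫ σ = trans (dot-liftedBiclique ⟪ σ ⟫)
    (cong₂ _+_ (cong₂ _+_ (cong₂ _+_ (sumℚ-cong (⟪⟫-vertexR σ)) (cong (ℕ→ℚ d *_) (⟪⟫-vertexR σ t))) (sumℚ-cong (⟪⟫-vertexS σ)))
               (sumℚ-cong (λ i → sumℚ-cong (⟪⟫-edge σ i))))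

  private
    Σ²0 : sumℚ {r} (λ _ → sumℚ {s} (λ _ → 0ℚ)) ≡ 0ℚ
    Σ²0 = sumℚ-zero {r} (λ _ → sumℚ-0 s)

  open +-*-Solver using (solve; _:=_; _:+_; _:*_; con)

  selectionWeight-allR : selectionWeight allR ≡ ℕ→ℚ s
  selectionWeight-allR = begin
    ((sumℚ {r} (λ _ → 1ℚ) + ℕ→ℚ d * 1ℚ) + sumℚ {s} (λ _ → 0ℚ)) + sumℚ {r} (λ _ → sumℚ {s} (λ _ → 0ℚ))
                                        ≡⟨ cong₂ _+_ (cong₂ _+_ (cong₂ _+_ (sumℚ-const-1 r) (*-identityʳ (ℕ→ℚ d))) (sumℚ-0 s)) Σ²0 ⟩
    ((ℕ→ℚ r + ℕ→ℚ d) + 0ℚ) + 0ℚ         ≡⟨ solve 2 (λ R D → ((R :+ D) :+ con 0ℚ) :+ con 0ℚ := R :+ D) refl (ℕ→ℚ r) (ℕ→ℚ d) ⟩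
    ℕ→ℚ r + ℕ→ℚ d                       ≡⟨ ℕ→ℚ-s ⟨
    ℕ→ℚ s                               ∎
    where open ≡-Reasoning

  selectionWeight-allS : selectionWeight allS ≡ ℕ→ℚ s
  selectionWeight-allS = begin
    ((sumℚ {r} (λ _ → 0ℚ) + ℕ→ℚ d * 0ℚ) + sumℚ {s} (λ _ → 1ℚ)) + sumℚ {r} (λ _ → sumℚ {s} (λ _ → 0ℚ))
                                        ≡⟨ cong₂ _+_ (cong₂ _+_ (cong₂ _+_ (sumℚ-0 r) (*-zeroʳ (ℕ→ℚ d))) (sumℚ-const-1 s)) Σ²0 ⟩
    ((0ℚ + 0ℚ) + ℕ→ℚ s) + 0ℚ            ≡⟨ solve 1 (λ S → ((con 0ℚ :+ con 0ℚ) :+ S) :+ con 0ℚ := S) refl (ℕ→ℚ s) ⟩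
    ℕ→ℚ s                               ∎
    where open ≡-Reasoning

  selectionWeight-R-swap : ∀ {v} w → v ≢ t → selectionWeight (R-swap v w) ≡ ℕ→ℚ s
  selectionWeight-R-swap {v} w v≢t = begin
    ((Σ≠v + ℕ→ℚ d * 𝟙 (not (t == v))) + sumℚ {s} (λ _ → 0ℚ)) + sumℚ (λ i → sumℚ (λ j → 𝟙 (i == v ∧ j == w)))
                                        ≡⟨ cong₂ _+_ (cong₂ _+_ (cong (λ b → Σ≠v + ℕ→ℚ d * 𝟙 (not b)) (==-≢ (v≢t ∘ sym))) (sumℚ-0 s))
                                                     (sumℚ²-𝟙-==-∧-== v w) ⟩
    ((Σ≠v + ℕ→ℚ d * 1ℚ) + 0ℚ) + 1ℚ      ≡⟨ solve 2 (λ X D → ((X :+ D :* con 1ℚ) :+ con 0ℚ) :+ con 1ℚ := (X :+ con 1ℚ) :+ D) refl Σ≠v (ℕ→ℚ d) ⟩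
    (Σ≠v + 1ℚ) + ℕ→ℚ d                  ≡⟨ cong (_+ ℕ→ℚ d) (sumℚ-𝟙-≠+1 v) ⟩
    ℕ→ℚ r + ℕ→ℚ d                       ≡⟨ ℕ→ℚ-s ⟨
    ℕ→ℚ s                               ∎
    where
    open ≡-Reasoning
    Σ≠v = sumℚ (λ i → 𝟙 (not (i == v)))

  selectionWeight-S-swap : ∀ v w → selectionWeight (S-swap v w) ≡ ℕ→ℚ s
  selectionWeight-S-swap v w = begin
    ((sumℚ {r} (λ _ → 0ℚ) + ℕ→ℚ d * 0ℚ) + Σ≠w) + sumℚ (λ i → sumℚ (λ j → 𝟙 (i == v ∧ j == w)))
                                        ≡⟨ cong₂ _+_ (cong (_+ Σ≠w) (cong₂ _+_ (sumℚ-0 r) (*-zeroʳ (ℕ→ℚ d)))) (sumℚ²-𝟙-==-∧-== v w) ⟩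
    ((0ℚ + 0ℚ) + Σ≠w) + 1ℚ              ≡⟨ solve 1 (λ X → ((con 0ℚ :+ con 0ℚ) :+ X) :+ con 1ℚ := X :+ con 1ℚ) refl Σ≠w ⟩
    Σ≠w + 1ℚ                            ≡⟨ sumℚ-𝟙-≠+1 w ⟩
    ℕ→ℚ s                               ∎
    where
    open ≡-Reasoning
    Σ≠w = sumℚ (λ j → 𝟙 (not (j == w)))

  module _ (w₀ : Fin s) {v₁ : Fin r} (v₁≢t : v₁ ≢ t) where

    data FaceView : Elem (K r s) → Set where
      R-t     : FaceView (vR t)
      R-≢t    : ∀ i → i ≢ t → FaceView (vR i)
      S-w₀    : FaceView (vS w₀)
      S-≢w₀   : ∀ j → j ≢ w₀ → FaceView (vS j)
      RS-edge : ∀ i j → FaceView (e i j)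

    faceView : ∀ c → FaceView c
    faceView c = refine (elemView {r} {s} c)
      where
      refine : ∀ {c} → ElemView {r} {s} c → FaceView c
      refine (R-vertex i) with i Fin.≟ t
      ... | yes refl = R-t
      ... | no  i≢t  = R-≢t i i≢t
      refine (S-vertex j) with j Fin.≟ w₀
      ... | yes refl = S-w₀
      ... | no  j≢w₀ = S-≢w₀ j j≢w₀
      refine (RS-edge i j) = RS-edge i j

    faceSelection : ∀ {c} → FaceView c → Sel
    faceSelection R-t           = allR
    faceSelection (R-≢t i _)    = R-swap i w₀
    faceSelection S-w₀          = allS
    faceSelection (S-≢w₀ j _)   = R-swap v₁ j
    faceSelection (RS-edge i j) = S-swap i j

    faceSelection-isIndependent : ∀ {c} (v : FaceView c) → IsIndependent (faceSelection v)
    faceSelection-isIndependent R-t           = allR-isIndependent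
    faceSelection-isIndependent (R-≢t i _)    = R-swap-isIndependent i w₀
    faceSelection-isIndependent S-w₀          = allS-isIndependent
    faceSelection-isIndependent (S-≢w₀ j _)   = R-swap-isIndependent v₁ j
    faceSelection-isIndependent (RS-edge i j) = S-swap-isIndependent i j

    faceSelection-tight : ∀ {c} (v : FaceView c) → selectionWeight (faceSelection v) ≡ ℕ→ℚ s
    faceSelection-tight R-t           = selectionWeight-allR
    faceSelection-tight (R-≢t i i≢t)  = selectionWeight-R-swap w₀ i≢t
    faceSelection-tight S-w₀          = selectionWeight-allS
    faceSelection-tight (S-≢w₀ j _)   = selectionWeight-R-swap j v₁≢t
    faceSelection-tight (RS-edge i j) = selectionWeight-S-swap i j

    rank : ∀ {c} → FaceView c → ℕ
    rank (S-≢w₀ _ _)   = 0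
    rank (R-≢t _ _)    = 1
    rank R-t           = 2
    rank (RS-edge _ _) = 2
    rank S-w₀          = 3

    -- The functionals witnessing independence of the face points, in coordinates (x, w, y).
    Φ : ∀ {c} → FaceView c → (Fin r → ℚ) → (Fin s → ℚ) → (Fin r → Fin s → ℚ) → ℚ
    Φ R-t           x w y = x t
    Φ (R-≢t i _)    x w y = x t - x i
    Φ S-w₀          x w y = 1ℚ
    Φ (S-≢w₀ j _)   x w y = ((x t + w j) + sumℚ (λ i → y i j)) - 1ℚ
    Φ (RS-edge i j) x w y = y i j

    ψ : ∀ {c} → FaceView c → Point (K r s) → ℚ
    ψ v p = Φ v (p ∘ vR) (p ∘ vS) (λ i j → p (e i j))

    ψₛ : ∀ {c} → FaceView c → Sel → ℚ
    ψₛ v σ = Φ v (𝟙 ∘ inR σ) (𝟙 ∘ inS σ) (λ i j → 𝟙 (inE σ i j))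

    ψ-isAffine : ∀ {c} (v : FaceView c) → IsAffine (K r s) (ψ v)
    ψ-isAffine R-t           = coord-isAffine (K r s) (vR t)
    ψ-isAffine (R-≢t i _)    = +-isAffine (K r s) (coord-isAffine (K r s) (vR t)) (-‿isAffine (K r s) (coord-isAffine (K r s) (vR i)))
    ψ-isAffine S-w₀          = const-isAffine (K r s) 1ℚ
    ψ-isAffine (S-≢w₀ j _)   = +-isAffine (K r s)
      (+-isAffine (K r s) (+-isAffine (K r s) (coord-isAffine (K r s) (vR t)) (coord-isAffine (K r s) (vS j)))
                          (sum-isAffine (K r s) (λ i → coord-isAffine (K r s) (e i j))))
      (-‿isAffine (K r s) (const-isAffine (K r s) 1ℚ))
    ψ-isAffine (RS-edge i j) = coord-isAffine (K r s) (e i j)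

    ψ-⟪⟫ : ∀ {c} (v : FaceView c) σ → ψ v ⟪ σ ⟫ ≡ ψₛ v σ
    ψ-⟪⟫ R-t           σ = ⟪⟫-vertexR σ t
    ψ-⟪⟫ (R-≢t i _)    σ = cong₂ _-_ (⟪⟫-vertexR σ t) (⟪⟫-vertexR σ i)
    ψ-⟪⟫ S-w₀          σ = refl
    ψ-⟪⟫ (S-≢w₀ j _)   σ = cong (_- 1ℚ) (cong₂ _+_ (cong₂ _+_ (⟪⟫-vertexR σ t) (⟪⟫-vertexS σ j)) (sumℚ-cong (λ i → ⟪⟫-edge σ i j)))
    ψ-⟪⟫ (RS-edge i j) σ = ⟪⟫-edge σ i j

    private
      1-𝟙-not : ∀ b → 1ℚ - 𝟙 (not b) ≡ 𝟙 b
      1-𝟙-not true  = refl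
      1-𝟙-not false = refl

    ψₛ-R-≢t-R-swap : ∀ {i} (i≢t : i ≢ t) {v} → v ≢ t → ∀ w → ψₛ (R-≢t i i≢t) (R-swap v w) ≡ 𝟙 (i == v)
    ψₛ-R-≢t-R-swap {i} _ {v} v≢t w =
      trans (cong (λ b → 𝟙 (not b) - 𝟙 (not (i == v))) (==-≢ (v≢t ∘ sym))) (1-𝟙-not (i == v))

    ψₛ-S-≢w₀-R-swap : ∀ {j} (j≢w₀ : j ≢ w₀) {v} → v ≢ t → ∀ w → ψₛ (S-≢w₀ j j≢w₀) (R-swap v w) ≡ 𝟙 (j == w)
    ψₛ-S-≢w₀-R-swap {j} _ {v} v≢t w = begin
      ((𝟙 (not (t == v)) + 0ℚ) + sumℚ (λ i → 𝟙 (i == v ∧ j == w))) - 1ℚ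
                                      ≡⟨ cong₂ (λ b z → ((𝟙 (not b) + 0ℚ) + z) - 1ℚ) (==-≢ (v≢t ∘ sym)) (sumℚ-𝟙-==-∧ v (j == w)) ⟩
      ((1ℚ + 0ℚ) + 𝟙 (j == w)) - 1ℚ   ≡⟨ solve 1 (λ x → ((con 1ℚ :+ con 0ℚ) :+ x) :- con 1ℚ := x) refl (𝟙 (j == w)) ⟩
      𝟙 (j == w)                      ∎
      where
      open ≡-Reasoning
      open +-*-Solver using (_:-_)

    ψₛ-S-≢w₀-S-swap : ∀ {j} (j≢w₀ : j ≢ w₀) v w → ψₛ (S-≢w₀ j j≢w₀) (S-swap v w) ≡ 0ℚ
    ψₛ-S-≢w₀-S-swap {j} _ v w = begin
      ((0ℚ + 𝟙 (not (j == w))) + sumℚ (λ i → 𝟙 (i == v ∧ j == w))) - 1ℚ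
                                          ≡⟨ cong (λ z → ((0ℚ + 𝟙 (not (j == w))) + z) - 1ℚ) (sumℚ-𝟙-==-∧ v (j == w)) ⟩
      ((0ℚ + 𝟙 (not (j == w))) + 𝟙 (j == w)) - 1ℚ
                                          ≡⟨ cong (λ z → (z + 𝟙 (j == w)) - 1ℚ) (+-identityˡ (𝟙 (not (j == w)))) ⟩
      (𝟙 (not (j == w)) + 𝟙 (j == w)) - 1ℚ ≡⟨ cong (_- 1ℚ) (𝟙-not+𝟙 (j == w)) ⟩
      1ℚ - 1ℚ                             ≡⟨ +-inverseʳ 1ℚ ⟩
      0ℚ                                  ∎
      where open ≡-Reasoning

    ψₛ-S-≢w₀-allR : ∀ {j} (j≢w₀ : j ≢ w₀) → ψₛ (S-≢w₀ j j≢w₀) allR ≡ 0ℚ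
    ψₛ-S-≢w₀-allR _ = cong (λ z → ((1ℚ + 0ℚ) + z) - 1ℚ) (sumℚ-0 r)

    ψₛ-S-≢w₀-allS : ∀ {j} (j≢w₀ : j ≢ w₀) → ψₛ (S-≢w₀ j j≢w₀) allS ≡ 0ℚ
    ψₛ-S-≢w₀-allS _ = cong (λ z → ((0ℚ + 1ℚ) + z) - 1ℚ) (sumℚ-0 r)

    ==-∧-==-≢ : ∀ {i i′ j j′} → e i′ j′ ≢ e i j → i == i′ ∧ j == j′ ≡ false
    ==-∧-==-≢ {i} {i′} {j} {j′} ij≢ with i Fin.≟ i′ | j Fin.≟ j′
    ... | yes refl | yes refl = ⊥-elim (ij≢ refl)
    ... | yes _    | no  _    = refl
    ... | no  _    | _        = refl

    ψₛ-diagonal : ∀ {c} (v : FaceView c) → ψₛ v (faceSelection v) ≡ 1ℚ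
    ψₛ-diagonal R-t           = refl
    ψₛ-diagonal (R-≢t i i≢t)  = trans (ψₛ-R-≢t-R-swap i≢t i≢t w₀) (cong 𝟙 (==-refl i))
    ψₛ-diagonal S-w₀          = refl
    ψₛ-diagonal (S-≢w₀ j j≢w₀) = trans (ψₛ-S-≢w₀-R-swap j≢w₀ v₁≢t j) (cong 𝟙 (==-refl j))
    ψₛ-diagonal (RS-edge i j) = cong₂ (λ a b → 𝟙 (a ∧ b)) (==-refl i) (==-refl j)

    ψₛ-upper : ∀ {c c′} (v : FaceView c) (v′ : FaceView c′) → c′ ≢ c → rank v ℕ.≤ rank v′ → ψₛ v (faceSelection v′) ≡ 0ℚ
    ψₛ-upper (S-≢w₀ j j≢w₀) R-t             _   _ = ψₛ-S-≢w₀-allR j≢w₀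
    ψₛ-upper (S-≢w₀ j j≢w₀) (R-≢t i i≢t)    _   _ = trans (ψₛ-S-≢w₀-R-swap j≢w₀ i≢t w₀) (cong 𝟙 (==-≢ j≢w₀))
    ψₛ-upper (S-≢w₀ j j≢w₀) S-w₀            _   _ = ψₛ-S-≢w₀-allS j≢w₀
    ψₛ-upper (S-≢w₀ j j≢w₀) (S-≢w₀ j′ _)    c′≢c _ = trans (ψₛ-S-≢w₀-R-swap j≢w₀ v₁≢t j′) (cong 𝟙 (==-≢ (c′≢c ∘ cong vS ∘ sym)))
    ψₛ-upper (S-≢w₀ j j≢w₀) (RS-edge i′ j′) _   _ = ψₛ-S-≢w₀-S-swap j≢w₀ i′ j′
    ψₛ-upper (R-≢t i _)     R-t             _   _ = refl
    ψₛ-upper (R-≢t i i≢t)   (R-≢t i′ i′≢t)  c′≢c _ = trans (ψₛ-R-≢t-R-swap i≢t i′≢t w₀) (cong 𝟙 (==-≢ (c′≢c ∘ cong vR ∘ sym)))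
    ψₛ-upper (R-≢t i _)     S-w₀            _   _ = refl
    ψₛ-upper (R-≢t i _)     (S-≢w₀ _ _)     _   ()
    ψₛ-upper (R-≢t i _)     (RS-edge _ _)   _   _ = refl
    ψₛ-upper R-t            R-t             c′≢c _ = ⊥-elim (c′≢c refl)
    ψₛ-upper R-t            (R-≢t _ _)      _   (s≤s ())
    ψₛ-upper R-t            S-w₀            _   _ = refl
    ψₛ-upper R-t            (S-≢w₀ _ _)     _   ()
    ψₛ-upper R-t            (RS-edge _ _)   _   _ = refl
    ψₛ-upper (RS-edge i j)  R-t             _   _ = refl
    ψₛ-upper (RS-edge i j)  (R-≢t _ _)      _   (s≤s ())
    ψₛ-upper (RS-edge i j)  S-w₀            _   _ = refl
    ψₛ-upper (RS-edge i j)  (S-≢w₀ _ _)     _   ()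
    ψₛ-upper (RS-edge i j)  (RS-edge i′ j′) c′≢c _ = cong 𝟙 (==-∧-==-≢ c′≢c)
    ψₛ-upper S-w₀           S-w₀            c′≢c _ = ⊥-elim (c′≢c refl)
    ψₛ-upper S-w₀           R-t             _   (s≤s (s≤s ()))
    ψₛ-upper S-w₀           (R-≢t _ _)      _   (s≤s ())
    ψₛ-upper S-w₀           (S-≢w₀ _ _)     _   ()
    ψₛ-upper S-w₀           (RS-edge _ _)   _   (s≤s (s≤s ()))

    facePoint : Fin (nElem (K r s)) → Point (K r s)
    facePoint k = ⟪ faceSelection (faceView (elemAt (K r s) k)) ⟫

    facePoint-tight : ∀ k → InPT (K r s) (facePoint k) × dot (K r s) (liftedBiclique r s t) (facePoint k) ≡ ℕ→ℚ s
    facePoint-tight k = χ-inPT (K r s) _ (isIndependent⇒isTotalMatching (faceSelection-isIndependent v)) ,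
                        trans (dot-liftedBiclique-⟪⟫ (faceSelection v)) (faceSelection-tight v)
      where v = faceView (elemAt (K r s) k)

    facePoint-affInd : AffInd (K r s) facePoint
    facePoint-affInd = affInd-unitriangular (K r s) facePoint (λ k → ψ (view k)) (λ k → rank (view k)) (λ k → ψ-isAffine (view k))
                                            diagonal upper
      where
      view : ∀ k → FaceView (elemAt (K r s) k)
      view k = faceView (elemAt (K r s) k)
      diagonal : ∀ k → ψ (view k) (facePoint k) ≡ 1ℚ
      diagonal k = trans (ψ-⟪⟫ (view k) _) (ψₛ-diagonal (view k))
      upper : ∀ k l → l ≢ k → rank (view k) ℕ.≤ rank (view l) → ψ (view k) (facePoint l) ≡ 0ℚ
      upper k l l≢k rank≤ = trans (ψ-⟪⟫ (view k) _) (ψₛ-upper (view k) (view l) (l≢k ∘ elemAt-injective (K r s)) rank≤)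

mainTheorem4 : (r s : ℕ) → 1 < r → r < s → (t : Fin r) →
    DefinesFacet (K r s) (liftedBiclique r s t) (ℕ→ℚ s)
mainTheorem4 r@(suc (suc _)) s@(suc s′) (s≤s (s≤s _)) r<s t =
  definesFacet (K r s) (liftedBiclique r s t) (ℕ→ℚ s) (ℕ→ℚ-suc≢0 s′) (liftedBiclique-valid t r≤s)
               (facePoint t r≤s zero v₁≢t) (facePoint-tight t r≤s zero v₁≢t) (facePoint-affInd t r≤s zero v₁≢t)
  where
  r≤s = ℕ.<⇒≤ r<s
  otherThan : (u : Fin r) → ∃[ v ] v ≢ u
  otherThan zero    = suc zero , λ ()
  otherThan (suc _) = zero , λ ()
  v₁≢t = proj₂ (otherThan t)
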